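{- Let $N>1$ be an integer. There is no proper subgroup $H$ of $\mathrm{SL}_2(\mathbb Z/N\mathbb Z)$ satisfying $\pm H=\mathrm{SL}_2(\mathbb Z/N\mathbb Z)$.
   Context: $\pm H$ denotes the subgroup generated by $H$ and $-I$. -}

module Defs where

open import Data.Nat using (ℕ; _+_; _*_; _∸_; NonZero)
open import Data.Nat.DivMod using (_mod_)
open import Data.Fin using (Fin; toℕ)
open import Data.Bool using (Bool; true)
open import Data.Product using (_×_; _,_; ∃-syntax)
open import Relation.Binary.PropositionalEquality using (_≡_)

module _ (N : ℕ) .{{_ : NonZero N}} where

  ZN : Set
  ZN = Fin N

  infixl 6 _⊕_
  infixl 7 _⊗_
  _⊕_ : ZN → ZN → ZN
  x ⊕ y = (toℕ x + toℕ y) mod N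

  _⊗_ : ZN → ZN → ZN
  x ⊗ y = (toℕ x * toℕ y) mod N

  ⊖_ : ZN → ZN
  ⊖ x = (N ∸ toℕ x) mod N

  0ₙ 1ₙ : ZN
  0ₙ = 0 mod N
  1ₙ = 1 mod N

  record Mat : Set where
    constructor mat
    field
      a b c d : ZN

  _·_ : Mat → Mat → Mat
  mat a b c d · mat a' b' c' d' =
    mat (a ⊗ a' ⊕ b ⊗ c') (a ⊗ b' ⊕ b ⊗ d') (c ⊗ a' ⊕ d ⊗ c') (c ⊗ b' ⊕ d ⊗ d')

  I -I : Mat
  I = mat 1ₙ 0ₙ 0ₙ 1ₙ
  -I = mat (⊖ 1ₙ) 0ₙ 0ₙ (⊖ 1ₙ)

  -- adjugate; this is the inverse of any matrix of determinant 1
  adj : Mat → Mat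
  adj (mat a b c d) = mat d (⊖ b) (⊖ c) a

  det : Mat → ZN
  det (mat a b c d) = a ⊗ d ⊕ ⊖ (b ⊗ c)

  InSL2 : Mat → Set
  InSL2 g = det g ≡ 1ₙ

  record IsSubgroupSL2 (H : Mat → Bool) : Set where
    field
      ⊆SL2  : ∀ g → H g ≡ true → InSL2 g
      has-I : H I ≡ true
      mul   : ∀ g h → H g ≡ true → H h ≡ true → H (g · h) ≡ true
      inv   : ∀ g → H g ≡ true → ∃[ h ] (H h ≡ true × g · h ≡ I)

  -- ±H : the subgroup of SL₂(ℤ/Nℤ) generated by H and -I
  data PM (H : Mat → Bool) : Mat → Set where
    gen   : ∀ g → H g ≡ true → PM H g
    neg   : PM H -I
    one   : PM H I
    _∙_   : ∀ {g h} → PM H g → PM H h → PM H (g · h)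
    invₚ  : ∀ {g} → PM H g → PM H (adj g)

{-# OPTIONS --safe #-}
-- Every element of ±H is h or −h with h ∈ H. The matrix S = [[0,−1],[1,0]] has
-- determinant 1 and S² = −I, so whichever of ±S lies in H squares to −I ∈ H;
-- then −g ∈ H gives g = (−I)(−g) ∈ H. The matrix identities over ℤ/Nℤ are
-- proved by lifting the entries to ℤ, where the ring solver decides them, and
-- reducing modulo N.
module Submission where

open import Defs
open import Data.Nat using (ℕ; _<_; NonZero)
open import Data.Bool using (Bool; true)
open import Relation.Binary.PropositionalEquality using (_≡_)

import Data.Nat as ℕ
import Data.Nat.Properties as ℕ
open import Data.Nat.DivMod using (_%_; _/_; _mod_; m≡m%n+[m/n]*n)
open import Data.Integer as ℤ using (ℤ; +_; +[1+_]; -[1+_])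
open import Data.Integer.Properties using (pos-+; pos-*; +-injective; ⊖-≥; m-n≡m⊖n)
open import Data.Integer.Tactic.RingSolver using (solve-∀)
open import Data.Integer.Solver using (module +-*-Solver)
open +-*-Solver using (Polynomial; op; con; var; _:^_; :-_; _:+_; _:*_; ⟦_⟧; ⟦_⟧↓; prove)
open import Algebra.Solver.Ring using (Op)
open import Data.Vec using (Vec; []; _∷_; lookup)
import Data.Vec as Vec
open import Data.Vec.Properties using (lookup-map)
open import Data.Fin using (toℕ; #_)
open import Data.Fin.Properties using (toℕ-injective; toℕ<n; toℕ-fromℕ<)
open import Data.Product using (_,_)
open import Data.Sum using (_⊎_; inj₁; inj₂)
open import Data.Empty using (⊥-elim)
open import Relation.Binary.PropositionalEquality
  using (refl; sym; trans; cong; cong₂; subst; module ≡-Reasoning)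

module Congruence (n : ℕ) where

  infix 4 _≋_
  record _≋_ (a b : ℤ) : Set where
    constructor multiple
    field
      quotient : ℤ
      a≡b+qn   : a ≡ b ℤ.+ quotient ℤ.* + n

  private
    a≡a+0*n : ∀ a n → a ≡ a ℤ.+ + 0 ℤ.* n
    a≡a+0*n = solve-∀

  ≋-refl : ∀ {a} → a ≋ a
  ≋-refl {a} = multiple (+ 0) (a≡a+0*n a (+ n))

  ≋-sym : ∀ {a b} → a ≋ b → b ≋ a
  ≋-sym {b = b} (multiple k a≡) =
    multiple (ℤ.- k) (trans (shift b k (+ n)) (cong (λ t → t ℤ.+ ℤ.- k ℤ.* + n) (sym a≡)))
    where
    shift : ∀ b k n → b ≡ (b ℤ.+ k ℤ.* n) ℤ.+ ℤ.- k ℤ.* n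
    shift = solve-∀

  ≋-trans : ∀ {a b c} → a ≋ b → b ≋ c → a ≋ c
  ≋-trans {c = c} (multiple k a≡) (multiple l b≡) =
    multiple (k ℤ.+ l) (trans a≡ (trans (cong (λ t → t ℤ.+ k ℤ.* + n) b≡) (regroup c k l (+ n))))
    where
    regroup : ∀ c k l n → (c ℤ.+ l ℤ.* n) ℤ.+ k ℤ.* n ≡ c ℤ.+ (k ℤ.+ l) ℤ.* n
    regroup = solve-∀

  +-cong : ∀ {a b c d} → a ≋ b → c ≋ d → a ℤ.+ c ≋ b ℤ.+ d
  +-cong {b = b} {d = d} (multiple k a≡) (multiple l c≡) =
    multiple (k ℤ.+ l) (trans (cong₂ ℤ._+_ a≡ c≡) (regroup b d k l (+ n)))
    where
    regroup : ∀ b d k l n → (b ℤ.+ k ℤ.* n) ℤ.+ (d ℤ.+ l ℤ.* n) ≡ (b ℤ.+ d) ℤ.+ (k ℤ.+ l) ℤ.* n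
    regroup = solve-∀

  *-cong : ∀ {a b c d} → a ≋ b → c ≋ d → a ℤ.* c ≋ b ℤ.* d
  *-cong {b = b} {d = d} (multiple k a≡) (multiple l c≡) =
    multiple (k ℤ.* d ℤ.+ b ℤ.* l ℤ.+ k ℤ.* l ℤ.* + n) (trans (cong₂ ℤ._*_ a≡ c≡) (expand b d k l (+ n)))
    where
    expand : ∀ b d k l n →
      (b ℤ.+ k ℤ.* n) ℤ.* (d ℤ.+ l ℤ.* n) ≡ b ℤ.* d ℤ.+ (k ℤ.* d ℤ.+ b ℤ.* l ℤ.+ k ℤ.* l ℤ.* n) ℤ.* n
    expand = solve-∀

  neg-cong : ∀ {a b} → a ≋ b → ℤ.- a ≋ ℤ.- b
  neg-cong {b = b} (multiple k a≡) = multiple (ℤ.- k) (trans (cong ℤ.-_ a≡) (distrib b k (+ n)))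
    where
    distrib : ∀ b k n → ℤ.- (b ℤ.+ k ℤ.* n) ≡ ℤ.- b ℤ.+ ℤ.- k ℤ.* n
    distrib = solve-∀

  residue-unique : ∀ {i j} → i < n → j < n → + i ≋ + j → i ≡ j
  residue-unique {j = j} _ _ (multiple (+ 0) i≡) = +-injective (trans i≡ (sym (a≡a+0*n (+ j) (+ n))))
  residue-unique {i} {j} i<n j<n (multiple +[1+ k ] i≡) = ⊥-elim (ℕ.<⇒≱ i<n n≤i)
    where
    i≡j+[1+k]n : i ≡ j ℕ.+ ℕ.suc k ℕ.* n
    i≡j+[1+k]n = +-injective (trans i≡ (trans (cong (ℤ._+_ (+ j)) (sym (pos-* (ℕ.suc k) n))) (sym (pos-+ j _))))
    n≤i : n ℕ.≤ i
    n≤i = subst (n ℕ.≤_) (sym i≡j+[1+k]n) (ℕ.≤-trans (ℕ.m≤m+n n (k ℕ.* n)) (ℕ.m≤n+m _ j))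
  residue-unique i<n j<n (multiple -[1+ k ] i≡) = sym (residue-unique j<n i<n (≋-sym (multiple -[1+ k ] i≡)))

module Residues (N : ℕ) .{{_ : NonZero N}} where

  open Congruence N

  toℤ : ZN N → ℤ
  toℤ x = + toℕ x

  toℤ-mod : ∀ m → toℤ (m mod N) ≋ + m
  toℤ-mod m = ≋-sym (multiple (+ (m / N)) (begin
    + m                           ≡⟨ cong +_ (m≡m%n+[m/n]*n m N) ⟩
    + (m % N ℕ.+ m / N ℕ.* N)     ≡⟨ pos-+ (m % N) (m / N ℕ.* N) ⟩
    + (m % N) ℤ.+ + (m / N ℕ.* N) ≡⟨ cong₂ ℤ._+_ (cong +_ (sym (toℕ-fromℕ< _))) (pos-* (m / N) N) ⟩
    toℤ (m mod N) ℤ.+ + (m / N) ℤ.* + N ∎))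
    where open ≡-Reasoning

  toℤ-⊕ : ∀ x y → toℤ (_⊕_ N x y) ≋ toℤ x ℤ.+ toℤ y
  toℤ-⊕ x y = subst (toℤ (_⊕_ N x y) ≋_) (pos-+ (toℕ x) (toℕ y)) (toℤ-mod _)

  toℤ-⊗ : ∀ x y → toℤ (_⊗_ N x y) ≋ toℤ x ℤ.* toℤ y
  toℤ-⊗ x y = subst (toℤ (_⊗_ N x y) ≋_) (pos-* (toℕ x) (toℕ y)) (toℤ-mod _)

  toℤ-⊖ : ∀ x → toℤ (⊖_ N x) ≋ ℤ.- toℤ x
  toℤ-⊖ x = ≋-trans (toℤ-mod _)
    (subst (_≋ ℤ.- toℤ x) N-x≡N∸x (multiple (+ 1) (N-x≡-x+N (+ N) (toℤ x))))
    where
    N-x≡-x+N : ∀ n x → n ℤ.+ ℤ.- x ≡ ℤ.- x ℤ.+ + 1 ℤ.* n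
    N-x≡-x+N = solve-∀
    N-x≡N∸x : + N ℤ.- toℤ x ≡ + (N ℕ.∸ toℕ x)
    N-x≡N∸x = trans (m-n≡m⊖n N (toℕ x)) (⊖-≥ (ℕ.<⇒≤ (toℕ<n x)))

  toℤ-injective : ∀ {x y} → toℤ x ≋ toℤ y → x ≡ y
  toℤ-injective x≋y = toℕ-injective (residue-unique (toℕ<n _) (toℕ<n _) x≋y)

  fromℤ : ℤ → ZN N
  fromℤ (+ m)    = m mod N
  fromℤ -[1+ m ] = ⊖_ N (ℕ.suc m mod N)

  toℤ-fromℤ : ∀ c → toℤ (fromℤ c) ≋ c
  toℤ-fromℤ (+ m)    = toℤ-mod m
  toℤ-fromℤ -[1+ m ] = ≋-trans (toℤ-⊖ _) (neg-cong (toℤ-mod (ℕ.suc m)))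

module ModularSolver (N : ℕ) .{{_ : NonZero N}} where

  open Congruence N
  open Residues N

  ⟦_⟧ᴺ : ∀ {m} → Polynomial m → Vec (ZN N) m → ZN N
  ⟦ op Op.[+] p q ⟧ᴺ ρ = _⊕_ N (⟦ p ⟧ᴺ ρ) (⟦ q ⟧ᴺ ρ)
  ⟦ op Op.[*] p q ⟧ᴺ ρ = _⊗_ N (⟦ p ⟧ᴺ ρ) (⟦ q ⟧ᴺ ρ)
  ⟦ con c ⟧ᴺ       ρ = fromℤ c
  ⟦ var x ⟧ᴺ       ρ = lookup ρ x
  ⟦ p :^ ℕ.zero ⟧ᴺ  ρ = 1ₙ N
  ⟦ p :^ ℕ.suc k ⟧ᴺ ρ = _⊗_ N (⟦ p ⟧ᴺ ρ) (⟦ p :^ k ⟧ᴺ ρ)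
  ⟦ :- p ⟧ᴺ        ρ = ⊖_ N (⟦ p ⟧ᴺ ρ)

  toℤ-⟦⟧ : ∀ {m} (p : Polynomial m) ρ → toℤ (⟦ p ⟧ᴺ ρ) ≋ ⟦ p ⟧ (Vec.map toℤ ρ)
  toℤ-⟦⟧ (op Op.[+] p q) ρ = ≋-trans (toℤ-⊕ (⟦ p ⟧ᴺ ρ) (⟦ q ⟧ᴺ ρ)) (+-cong (toℤ-⟦⟧ p ρ) (toℤ-⟦⟧ q ρ))
  toℤ-⟦⟧ (op Op.[*] p q) ρ = ≋-trans (toℤ-⊗ (⟦ p ⟧ᴺ ρ) (⟦ q ⟧ᴺ ρ)) (*-cong (toℤ-⟦⟧ p ρ) (toℤ-⟦⟧ q ρ))
  toℤ-⟦⟧ (con c)         ρ = toℤ-fromℤ c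
  toℤ-⟦⟧ (var x)         ρ = subst (toℤ (lookup ρ x) ≋_) (sym (lookup-map x toℤ ρ)) ≋-refl
  toℤ-⟦⟧ (p :^ ℕ.zero)   ρ = toℤ-mod 1
  toℤ-⟦⟧ (p :^ ℕ.suc k)  ρ = ≋-trans (toℤ-⊗ (⟦ p ⟧ᴺ ρ) (⟦ p :^ k ⟧ᴺ ρ)) (*-cong (toℤ-⟦⟧ p ρ) (toℤ-⟦⟧ (p :^ k) ρ))
  toℤ-⟦⟧ (:- p)          ρ = ≋-trans (toℤ-⊖ (⟦ p ⟧ᴺ ρ)) (neg-cong (toℤ-⟦⟧ p ρ))

  -- The hypothesis compares normal forms over ℤ, so it is refl whenever p = q
  -- is an identity of commutative rings.
  solve-mod : ∀ {m} (p q : Polynomial m) ρ →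
    ⟦ p ⟧↓ (Vec.map toℤ ρ) ≡ ⟦ q ⟧↓ (Vec.map toℤ ρ) → ⟦ p ⟧ᴺ ρ ≡ ⟦ q ⟧ᴺ ρ
  solve-mod p q ρ nf≡ = toℤ-injective
    (≋-trans (toℤ-⟦⟧ p ρ) (subst (_≋ toℤ (⟦ q ⟧ᴺ ρ)) (sym (prove _ p q nf≡)) (≋-sym (toℤ-⟦⟧ q ρ))))

module MatrixAlgebra (N : ℕ) .{{_ : NonZero N}} where

  open Residues N using (toℤ)
  open ModularSolver N

  Poly : Set
  Poly = Polynomial 12

  record MatPoly : Set where
    constructor mp
    field
      a b c d : Poly

  ⟦_⟧ₘ : MatPoly → Vec (ZN N) 12 → Mat N
  ⟦ mp a b c d ⟧ₘ ρ = mat (⟦ a ⟧ᴺ ρ) (⟦ b ⟧ᴺ ρ) (⟦ c ⟧ᴺ ρ) (⟦ d ⟧ᴺ ρ)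

  matPoly-≡ : ∀ P Q ρ → let open MatPoly in
    ⟦ a P ⟧↓ (Vec.map toℤ ρ) ≡ ⟦ a Q ⟧↓ (Vec.map toℤ ρ) →
    ⟦ b P ⟧↓ (Vec.map toℤ ρ) ≡ ⟦ b Q ⟧↓ (Vec.map toℤ ρ) →
    ⟦ c P ⟧↓ (Vec.map toℤ ρ) ≡ ⟦ c Q ⟧↓ (Vec.map toℤ ρ) →
    ⟦ d P ⟧↓ (Vec.map toℤ ρ) ≡ ⟦ d Q ⟧↓ (Vec.map toℤ ρ) →
    ⟦ P ⟧ₘ ρ ≡ ⟦ Q ⟧ₘ ρ
  matPoly-≡ (mp a b c d) (mp a' b' c' d') ρ a≡ b≡ c≡ d≡ =
    mat-cong (solve-mod a a' ρ a≡) (solve-mod b b' ρ b≡) (solve-mod c c' ρ c≡) (solve-mod d d' ρ d≡)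
    where
    mat-cong : ∀ {a a' b b' c c' d d'} → a ≡ a' → b ≡ b' → c ≡ c' → d ≡ d' → mat a b c d ≡ mat a' b' c' d'
    mat-cong refl refl refl refl = refl

  _⊠_ : MatPoly → MatPoly → MatPoly
  mp a b c d ⊠ mp a' b' c' d' =
    mp (a :* a' :+ b :* c') (a :* b' :+ b :* d') (c :* a' :+ d :* c') (c :* b' :+ d :* d')

  negateₚ adjₚ : MatPoly → MatPoly
  negateₚ (mp a b c d) = mp (:- a) (:- b) (:- c) (:- d)
  adjₚ    (mp a b c d) = mp d (:- b) (:- c) a

  detₚ : MatPoly → Poly
  detₚ (mp a b c d) = a :* d :+ :- (b :* c)

  0ₚ 1ₚ : Poly
  0ₚ = con (+ 0)
  1ₚ = con (+ 1)

  Iₚ -Iₚ Sₚ X Y Z : MatPoly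
  Iₚ = mp 1ₚ 0ₚ 0ₚ 1ₚ
  -Iₚ = mp (:- 1ₚ) 0ₚ 0ₚ (:- 1ₚ)
  Sₚ = mp 0ₚ (:- 1ₚ) 1ₚ 0ₚ
  X  = mp (var (# 0)) (var (# 1)) (var (# 2)) (var (# 3))
  Y  = mp (var (# 4)) (var (# 5)) (var (# 6)) (var (# 7))
  Z  = mp (var (# 8)) (var (# 9)) (var (# 10)) (var (# 11))

  -- ⟦ X ⟧ₘ, ⟦ Y ⟧ₘ and ⟦ Z ⟧ₘ at entries g h k are definitionally g, h and k;
  -- no identity below involves more than three matrices.
  entries : Mat N → Mat N → Mat N → Vec (ZN N) 12
  entries (mat a b c d) (mat a' b' c' d') (mat a'' b'' c'' d'') =
    a ∷ b ∷ c ∷ d ∷ a' ∷ b' ∷ c' ∷ d' ∷ a'' ∷ b'' ∷ c'' ∷ d'' ∷ []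

  negate : Mat N → Mat N
  negate (mat a b c d) = mat (⊖_ N a) (⊖_ N b) (⊖_ N c) (⊖_ N d)

  S : Mat N
  S = ⟦ Sₚ ⟧ₘ (entries (I N) (I N) (I N))

  infixl 7 _*ₘ_
  _*ₘ_ : Mat N → Mat N → Mat N
  _*ₘ_ = _·_ N

  ·-assoc : ∀ g h k → (g *ₘ h) *ₘ k ≡ g *ₘ (h *ₘ k)
  ·-assoc g h k = matPoly-≡ ((X ⊠ Y) ⊠ Z) (X ⊠ (Y ⊠ Z)) (entries g h k) refl refl refl refl

  ·-identityˡ : ∀ g → I N *ₘ g ≡ g
  ·-identityˡ g = matPoly-≡ (Iₚ ⊠ X) X (entries g g g) refl refl refl refl

  ·-identityʳ : ∀ g → g *ₘ I N ≡ g
  ·-identityʳ g = matPoly-≡ (X ⊠ Iₚ) X (entries g g g) refl refl refl refl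

  adj-inverseˡ : ∀ g → InSL2 N g → adj N g *ₘ g ≡ I N
  adj-inverseˡ g det≡1 = trans
    (matPoly-≡ (adjₚ X ⊠ X) (mp (detₚ X) 0ₚ 0ₚ (detₚ X)) (entries g g g) refl refl refl refl)
    (cong (λ δ → mat δ (0ₙ N) (0ₙ N) δ) det≡1)

  negate-·ˡ : ∀ g h → negate g *ₘ h ≡ negate (g *ₘ h)
  negate-·ˡ g h = matPoly-≡ (negateₚ X ⊠ Y) (negateₚ (X ⊠ Y)) (entries g h h) refl refl refl refl

  negate-·ʳ : ∀ g h → g *ₘ negate h ≡ negate (g *ₘ h)
  negate-·ʳ g h = matPoly-≡ (X ⊠ negateₚ Y) (negateₚ (X ⊠ Y)) (entries g h h) refl refl refl refl

  negate-·-negate : ∀ g h → negate g *ₘ negate h ≡ g *ₘ h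
  negate-·-negate g h = matPoly-≡ (negateₚ X ⊠ negateₚ Y) (X ⊠ Y) (entries g h h) refl refl refl refl

  -I-·-negate : ∀ g → -I N *ₘ negate g ≡ g
  -I-·-negate g = matPoly-≡ (-Iₚ ⊠ negateₚ X) X (entries g g g) refl refl refl refl

  negate--I : negate (-I N) ≡ I N
  negate--I = matPoly-≡ (negateₚ -Iₚ) Iₚ (entries (I N) (I N) (I N)) refl refl refl refl

  S·S≡-I : S *ₘ S ≡ -I N
  S·S≡-I = matPoly-≡ (Sₚ ⊠ Sₚ) -Iₚ (entries (I N) (I N) (I N)) refl refl refl refl

  S∈SL2 : InSL2 N S
  S∈SL2 = solve-mod (detₚ Sₚ) 1ₚ (entries (I N) (I N) (I N)) refl

module SubgroupOfSL2 (N : ℕ) .{{_ : NonZero N}} (H : Mat N → Bool) (H≤SL2 : IsSubgroupSL2 N H) where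

  open IsSubgroupSL2 H≤SL2
  open MatrixAlgebra N

  _∈H : Mat N → Set
  g ∈H = H g ≡ true

  ∈H-resp : ∀ {g h} → g ≡ h → g ∈H → h ∈H
  ∈H-resp = subst _∈H

  adj-∈H : ∀ g → g ∈H → adj N g ∈H
  adj-∈H g g∈H with inv g g∈H
  ... | h , h∈H , g·h≡I = ∈H-resp (sym adj≡h) h∈H
    where
    open ≡-Reasoning
    adj≡h : adj N g ≡ h
    adj≡h = begin
      adj N g              ≡⟨ sym (·-identityʳ (adj N g)) ⟩
      adj N g *ₘ I N       ≡⟨ cong (adj N g *ₘ_) (sym g·h≡I) ⟩
      adj N g *ₘ (g *ₘ h)  ≡⟨ sym (·-assoc (adj N g) g h) ⟩
      (adj N g *ₘ g) *ₘ h  ≡⟨ cong (_*ₘ h) (adj-inverseˡ g (⊆SL2 g g∈H)) ⟩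
      I N *ₘ h             ≡⟨ ·-identityˡ h ⟩
      h                    ∎

  ±H-element : ∀ {g} → PM N H g → g ∈H ⊎ negate g ∈H
  ±H-element (gen g g∈H) = inj₁ g∈H
  ±H-element neg         = inj₂ (∈H-resp (sym negate--I) has-I)
  ±H-element one         = inj₁ has-I
  ±H-element (_∙_ {g} {h} p q) with ±H-element p | ±H-element q
  ... | inj₁ g∈H  | inj₁ h∈H  = inj₁ (mul g h g∈H h∈H)
  ... | inj₁ g∈H  | inj₂ -h∈H = inj₂ (∈H-resp (negate-·ʳ g h) (mul g (negate h) g∈H -h∈H))
  ... | inj₂ -g∈H | inj₁ h∈H  = inj₂ (∈H-resp (negate-·ˡ g h) (mul (negate g) h -g∈H h∈H))
  ... | inj₂ -g∈H | inj₂ -h∈H = inj₁ (∈H-resp (negate-·-negate g h) (mul (negate g) (negate h) -g∈H -h∈H))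
  ±H-element (invₚ {g} p) with ±H-element p
  ... | inj₁ g∈H  = inj₁ (adj-∈H g g∈H)
  ... | inj₂ -g∈H = inj₂ (adj-∈H (negate g) -g∈H)

  ±S∈H⇒-I∈H : S ∈H ⊎ negate S ∈H → -I N ∈H
  ±S∈H⇒-I∈H (inj₁ S∈H)  = ∈H-resp S·S≡-I (mul S S S∈H S∈H)
  ±S∈H⇒-I∈H (inj₂ -S∈H) =
    ∈H-resp (trans (negate-·-negate S S) S·S≡-I) (mul (negate S) (negate S) -S∈H -S∈H)

  -I∈H⇒±g∈H⇒g∈H : -I N ∈H → ∀ g → g ∈H ⊎ negate g ∈H → g ∈H
  -I∈H⇒±g∈H⇒g∈H _    g (inj₁ g∈H)  = g∈H
  -I∈H⇒±g∈H⇒g∈H -I∈H g (inj₂ -g∈H) = ∈H-resp (-I-·-negate g) (mul (-I N) (negate g) -I∈H -g∈H)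

lemma7p8 : (N : ℕ) .{{_ : NonZero N}} → 1 < N →
    (H : Mat N → Bool) → IsSubgroupSL2 N H →
    (∀ g → InSL2 N g → PM N H g) →
    ∀ g → InSL2 N g → H g ≡ true
lemma7p8 N _ H H≤SL2 ±H⊇SL2 g g∈SL2 =
  -I∈H⇒±g∈H⇒g∈H -I∈H g (±H-element (±H⊇SL2 g g∈SL2))
  where
  open SubgroupOfSL2 N H H≤SL2
  open MatrixAlgebra N using (S; S∈SL2)
  -I∈H : -I N ∈H
  -I∈H = ±S∈H⇒-I∈H (±H-element (±H⊇SL2 S S∈SL2))
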